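{- For every $k\ge0$, $\mathrm{U}_k^+=\mathcal{R}_k$ and $\mathrm{E}_k^+=\mathcal{J}_k$.
   Context: Formulas are those of the language of intuitionistic arithmetic $\mathsf{HA}$ (function symbols for all primitive recursive functions; logical constants $\forall,\exists,\to,\land,\lor,\perp$). Equality $\Gamma=\Gamma'$ of classes of formulas is understood modulo $\mathsf{HA}$-equivalence: every $\varphi\in\Gamma$ has some $\varphi'\in\Gamma'$ with the same free variables and $\mathsf{HA}\vdash\varphi\leftrightarrow\varphi'$, and vice versa. $\Sigma_0$ is the class of quantifier-free formulas. Degree: an alternation path is a finite sequence of symbols $+,-$ in which they alternate; $i(s)$ is the first symbol of $s$ if nonempty and $\times$ if empty, $s^\perp$ swaps $+$ and $-$, $l(s)$ is the length. $\mathrm{Alt}(\varphi)=\{\langle\rangle\}$ if $\varphi$ is quantifier-free; otherwise $\mathrm{Alt}(\varphi_1\land\varphi_2)=\mathrm{Alt}(\varphi_1\lor\varphi_2)=\mathrm{Alt}(\varphi_1)\cup\mathrm{Alt}(\varphi_2)$, $\mathrm{Alt}(\varphi_1\to\varphi_2)=\{s^\perp:s\in\mathrm{Alt}(\varphi_1)\}\cup\mathrm{Alt}(\varphi_2)$, $\mathrm{Alt}(\forall x\varphi_1)=\{s\in\mathrm{Alt}(\varphi_1):i(s)=-\}\cup\{ -s:s\in\mathrm{Alt}(\varphi_1),i(s)\ne-\}$, $\mathrm{Alt}(\exists x\varphi_1)=\{s\in\mathrm{Alt}(\varphi_1):i(s)=+\}\cup\{+s:s\in\mathrm{Alt}(\varphi_1),i(s)\ne+\}$.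 $\deg(\varphi)=\max\{l(s):s\in\mathrm{Alt}(\varphi)\}$. $\mathrm{F}_k$ = formulas of degree $k$, $\mathrm{F}_k^+$ = formulas of degree $\le k$; $\mathrm{U}_0=\mathrm{E}_0=\mathrm{F}_0$; $\mathrm{U}_{k+1}$ = formulas $\varphi\in\mathrm{F}_{k+1}$ such that $i(s)=-$ for all $s\in\mathrm{Alt}(\varphi)$ with $l(s)=k+1$; $\mathrm{E}_{k+1}$ likewise with $+$; $\mathrm{U}_k^+=\mathrm{U}_k\cup\bigcup_{i<k}\mathrm{F}_i$, $\mathrm{E}_k^+=\mathrm{E}_k\cup\bigcup_{i<k}\mathrm{F}_i$. $\mathcal{R}_0=\mathcal{J}_0=\Sigma_0$; $\mathcal{R}_{k+1},\mathcal{J}_{k+1}$ are simultaneously inductively generated by: every formula of $\mathrm{F}_k^+$ is in both; for $R,R'\in\mathcal{R}_{k+1}$, $J,J'\in\mathcal{J}_{k+1}$: $R\land R',R\lor R',\forall xR,J\to R\in\mathcal{R}_{k+1}$ and $J\land J',J\lor J',\exists xJ,R\to J\in\mathcal{J}_{k+1}$. -}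

module Defs where

open import Data.Nat using (ℕ; zero; suc; _≤_; _<_; _⊔_; _≡ᵇ_)
open import Data.Fin using (Fin)
open import Data.Vec using (Vec; []; _∷_; lookup)
open import Data.List using (List; []; _∷_; _++_; map; length; filter)
open import Data.Bool using (Bool; true; false; _∨_)
open import Data.Maybe using (Maybe; just; nothing)
open import Data.Product using (Σ; _×_; _,_)
open import Data.Sum using (_⊎_)
open import Data.Empty using (⊥)
open import Data.Unit using (⊤)
open import Data.List.Relation.Unary.All using (All)
open import Relation.Binary.PropositionalEquality using (_≡_; _≢_)
open import Relation.Nullary using (¬_)
open import Data.List.Membership.Propositional using (_∈_)

data PR : ℕ → Set where
  zer  : PR 0
  succ : PR 1
  proj : ∀ {n} → Fin n → PR n
  comp : ∀ {m n} → PR m → Vec (PR n) m → PR n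
  prec : ∀ {n} → PR n → PR (suc (suc n)) → PR (suc n)
  -- prec f g (0 , xs) = f xs ; prec f g (S y , xs) = g (prec f g (y , xs) , y , xs)

-- Terms with de Bruijn-indexed variables
data Term : Set where
  var : ℕ → Term
  app : ∀ {n} → PR n → Vec Term n → Term

data Formula : Set where
  _≐_  : Term → Term → Formula
  ⊥'   : Formula
  _∧'_ : Formula → Formula → Formula
  _∨'_ : Formula → Formula → Formula
  _⇒_  : Formula → Formula → Formula
  ∀'   : Formula → Formula
  ∃'   : Formula → Formula

infix  7 _≐_
infixr 6 _∧'_
infixr 5 _∨'_
infixr 4 _⇒_

_⇔'_ : Formula → Formula → Formula
φ ⇔' ψ = (φ ⇒ ψ) ∧' (ψ ⇒ φ)

Z' : Term
Z' = app zer []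

S' : Term → Term
S' t = app succ (t ∷ [])

liftR : (ℕ → ℕ) → ℕ → ℕ
liftR ρ zero    = zero
liftR ρ (suc n) = suc (ρ n)

mutual
  renT : (ℕ → ℕ) → Term → Term
  renT ρ (var n)    = var (ρ n)
  renT ρ (app f ts) = app f (renV ρ ts)

  renV : ∀ {n} → (ℕ → ℕ) → Vec Term n → Vec Term n
  renV ρ []       = []
  renV ρ (t ∷ ts) = renT ρ t ∷ renV ρ ts

ren : (ℕ → ℕ) → Formula → Formula
ren ρ (t ≐ s)  = renT ρ t ≐ renT ρ s
ren ρ ⊥'       = ⊥'
ren ρ (φ ∧' ψ) = ren ρ φ ∧' ren ρ ψ
ren ρ (φ ∨' ψ) = ren ρ φ ∨' ren ρ ψ
ren ρ (φ ⇒ ψ)  = ren ρ φ ⇒ ren ρ ψ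
ren ρ (∀' φ)   = ∀' (ren (liftR ρ) φ)
ren ρ (∃' φ)   = ∃' (ren (liftR ρ) φ)

shift : Formula → Formula
shift = ren suc

liftS : (ℕ → Term) → ℕ → Term
liftS σ zero    = var zero
liftS σ (suc n) = renT suc (σ n)

mutual
  subT : (ℕ → Term) → Term → Term
  subT σ (var n)    = σ n
  subT σ (app f ts) = app f (subV σ ts)

  subV : ∀ {n} → (ℕ → Term) → Vec Term n → Vec Term n
  subV σ []       = []
  subV σ (t ∷ ts) = subT σ t ∷ subV σ ts

sub : (ℕ → Term) → Formula → Formula
sub σ (t ≐ s)  = subT σ t ≐ subT σ s
sub σ ⊥'       = ⊥'
sub σ (φ ∧' ψ) = sub σ φ ∧' sub σ ψ
sub σ (φ ∨' ψ) = sub σ φ ∨' sub σ ψ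
sub σ (φ ⇒ ψ)  = sub σ φ ⇒ sub σ ψ
sub σ (∀' φ)   = ∀' (sub (liftS σ) φ)
sub σ (∃' φ)   = ∃' (sub (liftS σ) φ)

sub0 : Term → ℕ → Term
sub0 t zero    = t
sub0 t (suc n) = var n

_[_]₀ : Formula → Term → Formula
φ [ t ]₀ = sub (sub0 t) φ

-- replace index 0 by t, keeping the other indices (used under a binder)
sub0keep : Term → ℕ → Term
sub0keep t zero    = t
sub0keep t (suc n) = var (suc n)

mutual
  occT : ℕ → Term → Bool
  occT n (var m)    = n ≡ᵇ m
  occT n (app f ts) = occV n ts

  occV : ∀ {k} → ℕ → Vec Term k → Bool
  occV n []       = false
  occV n (t ∷ ts) = occT n t ∨ occV n ts

occurs : ℕ → Formula → Bool
occurs n (t ≐ s)  = occT n t ∨ occT n s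
occurs n ⊥'       = false
occurs n (φ ∧' ψ) = occurs n φ ∨ occurs n ψ
occurs n (φ ∨' ψ) = occurs n φ ∨ occurs n ψ
occurs n (φ ⇒ ψ)  = occurs n φ ∨ occurs n ψ
occurs n (∀' φ)   = occurs (suc n) φ
occurs n (∃' φ)   = occurs (suc n) φ

SameFV : Formula → Formula → Set
SameFV φ ψ = ∀ n → occurs n φ ≡ occurs n ψ

mapT : ∀ {n m} → (PR n → Term) → Vec (PR n) m → Vec Term m
mapT h []       = []
mapT h (g ∷ gs) = h g ∷ mapT h gs

infix 2 _⊢_

data _⊢_ (Γ : List Formula) : Formula → Set where
  hyp    : ∀ {φ} → φ ∈ Γ → Γ ⊢ φ
  ⊥-e    : ∀ {φ} → Γ ⊢ ⊥' → Γ ⊢ φ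
  ∧-i    : ∀ {φ ψ} → Γ ⊢ φ → Γ ⊢ ψ → Γ ⊢ φ ∧' ψ
  ∧-e₁   : ∀ {φ ψ} → Γ ⊢ φ ∧' ψ → Γ ⊢ φ
  ∧-e₂   : ∀ {φ ψ} → Γ ⊢ φ ∧' ψ → Γ ⊢ ψ
  ∨-i₁   : ∀ {φ ψ} → Γ ⊢ φ → Γ ⊢ φ ∨' ψ
  ∨-i₂   : ∀ {φ ψ} → Γ ⊢ ψ → Γ ⊢ φ ∨' ψ
  ∨-e    : ∀ {φ ψ χ} → Γ ⊢ φ ∨' ψ → (φ ∷ Γ) ⊢ χ → (ψ ∷ Γ) ⊢ χ → Γ ⊢ χ
  ⇒-i    : ∀ {φ ψ} → (φ ∷ Γ) ⊢ ψ → Γ ⊢ φ ⇒ ψ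
  ⇒-e    : ∀ {φ ψ} → Γ ⊢ φ ⇒ ψ → Γ ⊢ φ → Γ ⊢ ψ
  ∀-i    : ∀ {φ} → map shift Γ ⊢ φ → Γ ⊢ ∀' φ
  ∀-e    : ∀ {φ} (t : Term) → Γ ⊢ ∀' φ → Γ ⊢ φ [ t ]₀
  ∃-i    : ∀ {φ} (t : Term) → Γ ⊢ φ [ t ]₀ → Γ ⊢ ∃' φ
  ∃-e    : ∀ {φ ψ} → Γ ⊢ ∃' φ → (φ ∷ map shift Γ) ⊢ shift ψ → Γ ⊢ ψ
  ≐-refl : ∀ t → Γ ⊢ t ≐ t
  ≐-subst : ∀ {φ t s} → Γ ⊢ t ≐ s → Γ ⊢ φ [ t ]₀ → Γ ⊢ φ [ s ]₀
  S≢Z    : ∀ t → Γ ⊢ S' t ≐ Z' ⇒ ⊥'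
  S-inj  : ∀ t s → Γ ⊢ S' t ≐ S' s ⇒ t ≐ s
  ax-proj : ∀ {n} (i : Fin n) (ts : Vec Term n) → Γ ⊢ app (proj i) ts ≐ lookup ts i
  ax-comp : ∀ {m n} (f : PR m) (gs : Vec (PR n) m) (ts : Vec Term n) →
            Γ ⊢ app (comp f gs) ts ≐ app f (mapT (λ g → app g ts) gs)
  ax-rec0 : ∀ {n} (f : PR n) (g : PR (suc (suc n))) (ts : Vec Term n) →
            Γ ⊢ app (prec f g) (Z' ∷ ts) ≐ app f ts
  ax-recS : ∀ {n} (f : PR n) (g : PR (suc (suc n))) (t : Term) (ts : Vec Term n) →
            Γ ⊢ app (prec f g) (S' t ∷ ts) ≐ app g (app (prec f g) (t ∷ ts) ∷ t ∷ ts)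
  ind    : ∀ {φ} → Γ ⊢ φ [ Z' ]₀ → Γ ⊢ ∀' (φ ⇒ sub (sub0keep (S' (var zero))) φ) → Γ ⊢ ∀' φ

HA⊢ : Formula → Set
HA⊢ φ = [] ⊢ φ

data Sign : Set where
  plus minus : Sign

-- an alternation path; the operations below only ever produce alternating lists
Path : Set
Path = List Sign

-- i(s): first symbol, or nothing (= ×) if empty
ini : Path → Maybe Sign
ini []      = nothing
ini (x ∷ _) = just x

flipS : Sign → Sign
flipS plus  = minus
flipS minus = plus

_⊥ₚ : Path → Path
s ⊥ₚ = map flipS s

isMinus : Maybe Sign → Bool
isMinus (just minus) = true
isMinus _            = false

isPlus : Maybe Sign → Bool
isPlus (just plus) = true
isPlus _           = false

not : Bool → Bool
not true  = false
not false = true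

altQ : Sign → (Maybe Sign → Bool) → List Path → List Path
altQ σ p []       = []
altQ σ p (s ∷ ss) with p (ini s)
... | true  = s ∷ altQ σ p ss
... | false = (σ ∷ s) ∷ altQ σ p ss

-- Alt(φ) as a finite list (set semantics); for quantifier-free φ this
-- computes {⟨⟩}, agreeing with the base clause of the paper
Alt : Formula → List Path
Alt (t ≐ s)  = [] ∷ []
Alt ⊥'       = [] ∷ []
Alt (φ ∧' ψ) = Alt φ ++ Alt ψ
Alt (φ ∨' ψ) = Alt φ ++ Alt ψ
Alt (φ ⇒ ψ)  = map _⊥ₚ (Alt φ) ++ Alt ψ
Alt (∀' φ)   = altQ minus isMinus (Alt φ)
Alt (∃' φ)   = altQ plus isPlus (Alt φ)

maxLen : List Path → ℕ
maxLen []       = 0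
maxLen (s ∷ ss) = length s ⊔ maxLen ss

deg : Formula → ℕ
deg φ = maxLen (Alt φ)

Class : Set₁
Class = Formula → Set

QF : Class
QF (t ≐ s)  = ⊤
QF ⊥'       = ⊤
QF (φ ∧' ψ) = QF φ × QF ψ
QF (φ ∨' ψ) = QF φ × QF ψ
QF (φ ⇒ ψ)  = QF φ × QF ψ
QF (∀' φ)   = ⊥
QF (∃' φ)   = ⊥

Σ₀ : Class
Σ₀ = QF

F : ℕ → Class
F k φ = deg φ ≡ k

F⁺ : ℕ → Class
F⁺ k φ = deg φ ≤ k

U : ℕ → Class
U zero    = F zero
U (suc k) φ = F (suc k) φ × All (λ s → length s ≡ suc k → ini s ≡ just minus) (Alt φ)

E : ℕ → Class
E zero    = F zero
E (suc k) φ = F (suc k) φ × All (λ s → length s ≡ suc k → ini s ≡ just plus) (Alt φ)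

U⁺ : ℕ → Class
U⁺ k φ = U k φ ⊎ deg φ < k

E⁺ : ℕ → Class
E⁺ k φ = E k φ ⊎ deg φ < k

-- R_{k+1} and J_{k+1}, simultaneously inductively generated
mutual
  data Rs (k : ℕ) : Formula → Set where
    r-base : ∀ {φ} → F⁺ k φ → Rs k φ
    r-∧    : ∀ {φ ψ} → Rs k φ → Rs k ψ → Rs k (φ ∧' ψ)
    r-∨    : ∀ {φ ψ} → Rs k φ → Rs k ψ → Rs k (φ ∨' ψ)
    r-∀    : ∀ {φ} → Rs k φ → Rs k (∀' φ)
    r-⇒    : ∀ {φ ψ} → Js k φ → Rs k ψ → Rs k (φ ⇒ ψ)

  data Js (k : ℕ) : Formula → Set where
    j-base : ∀ {φ} → F⁺ k φ → Js k φ
    j-∧    : ∀ {φ ψ} → Js k φ → Js k ψ → Js k (φ ∧' ψ)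
    j-∨    : ∀ {φ ψ} → Js k φ → Js k ψ → Js k (φ ∨' ψ)
    j-∃    : ∀ {φ} → Js k φ → Js k (∃' φ)
    j-⇒    : ∀ {φ ψ} → Rs k φ → Js k ψ → Js k (φ ⇒ ψ)

ℛ : ℕ → Class
ℛ zero    = Σ₀
ℛ (suc k) = Rs k

𝒥 : ℕ → Class
𝒥 zero    = Σ₀
𝒥 (suc k) = Js k

_⊑_ : Class → Class → Set
Γ ⊑ Γ' = ∀ φ → Γ φ → Σ Formula (λ φ' → Γ' φ' × SameFV φ φ' × HA⊢ (φ ⇔' φ'))

_≡HA_ : Class → Class → Set
Γ ≡HA Γ' = (Γ ⊑ Γ') × (Γ' ⊑ Γ)

-- Both sides are described by one property of the alternation paths of φ: all have length at
-- most k+1, and those of length k+1 start with − (for ℛ) or + (for 𝒥). For ℛ and 𝒥 this is an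
-- induction on φ: ∀ keeps the property because it only prefixes − to paths not already starting
-- with −, an ∃ under ℛ must keep every path at length ≤ k since all its paths start with +, and
-- the antecedent of an implication contributes its paths with signs swapped, exchanging ℛ and 𝒥.
-- The classes therefore coincide outright, and every formula is its own HA-equivalent witness.
module Submission where

open import Defs
open import Data.Nat using (ℕ; zero; suc; _≤_; _<_; z≤n; s≤s)
open import Data.Nat.Properties
  using (⊔-lub; m⊔n≤o⇒m≤o; m⊔n≤o⇒n≤o; m≤n⇒m<n∨m≡n; m≤n⇒m≤1+n; 1+n≰n; n≤0⇒n≡0; ≤-reflexive)
open import Data.Maybe.Properties using (just-injective)
open import Data.Product using (_×_; _,_)
open import Data.Sum using (_⊎_; inj₁; inj₂)
open import Data.Bool using (Bool; true; false)
open import Data.Maybe using (Maybe; just; nothing)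
open import Data.Empty using (⊥-elim)
open import Data.List using (List; []; _∷_; map; length)
open import Data.List.Properties using (length-map; ++-conicalʳ)
open import Data.List.Relation.Unary.All as All using (All; []; _∷_)
open import Data.List.Relation.Unary.All.Properties using (++⁺; ++⁻ˡ; ++⁻ʳ; map⁺; map⁻)
open import Data.List.Relation.Unary.Any using (here)
open import Relation.Nullary using (¬_)
open import Relation.Nullary.Reflects using (Reflects; ofʸ; ofⁿ)
open import Relation.Binary.PropositionalEquality using (_≡_; _≢_; refl; sym; trans; subst)

LengthAtMost : ℕ → Path → Set
LengthAtMost n s = length s ≤ n

StartsWith : Sign → Path → Set
StartsWith σ s = ini s ≡ just σ

Admissible : Sign → ℕ → Path → Set
Admissible σ k s = LengthAtMost (suc k) s × (length s ≡ suc k → StartsWith σ s)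

-- U⁺ (suc k) is this class for σ = minus, E⁺ (suc k) for σ = plus.
MaximalPathsStartWith : Sign → ℕ → Class
MaximalPathsStartWith σ k φ =
  (F (suc k) φ × All (λ s → length s ≡ suc k → StartsWith σ s) (Alt φ)) ⊎ deg φ < suc k

Tests : Sign → (Maybe Sign → Bool) → Set
Tests σ p = ∀ m → Reflects (m ≡ just σ) (p m)

isPlus-tests : Tests plus isPlus
isPlus-tests nothing      = ofⁿ λ ()
isPlus-tests (just plus)  = ofʸ refl
isPlus-tests (just minus) = ofⁿ λ ()

isMinus-tests : Tests minus isMinus
isMinus-tests nothing      = ofⁿ λ ()
isMinus-tests (just plus)  = ofⁿ λ ()
isMinus-tests (just minus) = ofʸ refl

flipS-≢ : ∀ σ → flipS σ ≢ σ
flipS-≢ plus  ()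
flipS-≢ minus ()

maxLen≤⇒All : ∀ {n} L → maxLen L ≤ n → All (LengthAtMost n) L
maxLen≤⇒All []       _ = []
maxLen≤⇒All (s ∷ ss) p =
  m⊔n≤o⇒m≤o (length s) (maxLen ss) p ∷ maxLen≤⇒All ss (m⊔n≤o⇒n≤o (length s) (maxLen ss) p)

All⇒maxLen≤ : ∀ {n L} → All (LengthAtMost n) L → maxLen L ≤ n
All⇒maxLen≤ []       = z≤n
All⇒maxLen≤ (p ∷ ps) = ⊔-lub p (All⇒maxLen≤ ps)

short⇒admissible : ∀ {σ k} s → LengthAtMost k s → Admissible σ k s
short⇒admissible s p = m≤n⇒m≤1+n p , λ e → ⊥-elim (1+n≰n (subst (_≤ _) e p))

admissible⇒short : ∀ {σ k} s → Admissible σ k s → ¬ StartsWith σ s → LengthAtMost k s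
admissible⇒short s (le , top) ¬start with m≤n⇒m<n∨m≡n le
... | inj₁ (s≤s lt) = lt
... | inj₂ e        = ⊥-elim (¬start (top e))

admissible⇒short-opposite : ∀ {σ k} s → Admissible (flipS σ) k s → StartsWith σ s → LengthAtMost k s
admissible⇒short-opposite {σ} s a start =
  admissible⇒short s a λ start′ → flipS-≢ σ (just-injective (trans (sym start′) start))

maximalPathsStartWith⇒admissible : ∀ {σ k} φ →
  MaximalPathsStartWith σ k φ → All (Admissible σ k) (Alt φ)
maximalPathsStartWith⇒admissible φ (inj₁ (d , top)) =
  All.zip (maxLen≤⇒All (Alt φ) (≤-reflexive d) , top)
maximalPathsStartWith⇒admissible φ (inj₂ (s≤s d)) =
  All.map (λ {s} → short⇒admissible s) (maxLen≤⇒All (Alt φ) d)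

admissible⇒maximalPathsStartWith : ∀ {σ k} φ →
  All (Admissible σ k) (Alt φ) → MaximalPathsStartWith σ k φ
admissible⇒maximalPathsStartWith φ a with All.unzip a
... | short , top with m≤n⇒m<n∨m≡n (All⇒maxLen≤ short)
...   | inj₁ lt = inj₂ lt
...   | inj₂ d  = inj₁ (d , top)

⊥ₚ-startsWith : ∀ {σ} s → StartsWith σ s → StartsWith (flipS σ) (s ⊥ₚ)
⊥ₚ-startsWith (_ ∷ _) refl = refl

⊥ₚ-startsWith⁻ : ∀ {σ} s → StartsWith (flipS σ) (s ⊥ₚ) → StartsWith σ s
⊥ₚ-startsWith⁻ {plus}  (plus ∷ _)  refl = refl
⊥ₚ-startsWith⁻ {minus} (minus ∷ _) refl = refl
⊥ₚ-startsWith⁻ {plus}  (minus ∷ _) ()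
⊥ₚ-startsWith⁻ {minus} (plus ∷ _)  ()

admissible-⊥ₚ : ∀ {σ k} s → Admissible σ k s → Admissible (flipS σ) k (s ⊥ₚ)
admissible-⊥ₚ s (le , top) rewrite length-map flipS s = le , λ e → ⊥ₚ-startsWith s (top e)

admissible-⊥ₚ⁻ : ∀ {σ k} s → Admissible (flipS σ) k (s ⊥ₚ) → Admissible σ k s
admissible-⊥ₚ⁻ s (le , top) rewrite length-map flipS s = le , λ e → ⊥ₚ-startsWith⁻ s (top e)

All-admissible-⊥ₚ : ∀ {σ k L} → All (Admissible σ k) L → All (Admissible (flipS σ) k) (map _⊥ₚ L)
All-admissible-⊥ₚ as = map⁺ (All.map (λ {s} → admissible-⊥ₚ s) as)

All-admissible-⊥ₚ⁻ : ∀ {σ k L} → All (Admissible (flipS σ) k) (map _⊥ₚ L) → All (Admissible σ k) L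
All-admissible-⊥ₚ⁻ as = All.map (λ {s} → admissible-⊥ₚ⁻ s) (map⁻ as)

module _ {σ : Sign} {p : Maybe Sign → Bool} (tests : Tests σ p) where

  altQ-startsWith : ∀ L → All (StartsWith σ) (altQ σ p L)
  altQ-startsWith []      = []
  altQ-startsWith (s ∷ L) with p (ini s) | tests (ini s)
  ... | true  | ofʸ start = start ∷ altQ-startsWith L
  ... | false | ofⁿ _     = refl ∷ altQ-startsWith L

  altQ-admissible : ∀ {k L} → All (Admissible σ k) L → All (Admissible σ k) (altQ σ p L)
  altQ-admissible [] = []
  altQ-admissible (_∷_ {s} a as) with p (ini s) | tests (ini s)
  ... | true  | ofʸ _      = a ∷ altQ-admissible as
  ... | false | ofⁿ ¬start = (s≤s (admissible⇒short s a ¬start) , λ _ → refl) ∷ altQ-admissible as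

  altQ-admissible⁻ : ∀ {k} L → All (Admissible σ k) (altQ σ p L) → All (Admissible σ k) L
  altQ-admissible⁻ []      [] = []
  altQ-admissible⁻ (s ∷ L) as with p (ini s) | tests (ini s)
  altQ-admissible⁻ (s ∷ L) (a ∷ as) | true | ofʸ _ = a ∷ altQ-admissible⁻ L as
  altQ-admissible⁻ (s ∷ L) ((s≤s le , _) ∷ as) | false | ofⁿ _ =
    short⇒admissible s le ∷ altQ-admissible⁻ L as

  altQ-admissible-opposite⇒short : ∀ {k} L →
    All (Admissible (flipS σ) k) (altQ σ p L) → maxLen (altQ σ p L) ≤ k
  altQ-admissible-opposite⇒short L as = All⇒maxLen≤
    (All.zipWith (λ {s} (a , start) → admissible⇒short-opposite s a start) (as , altQ-startsWith L))

  altQ-≡[] : ∀ L → altQ σ p L ≡ [] → L ≡ []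
  altQ-≡[] []      _ = refl
  altQ-≡[] (s ∷ L) e with p (ini s)
  altQ-≡[] (s ∷ L) () | true
  altQ-≡[] (s ∷ L) () | false

mutual
  admissible⇒Rs : ∀ {k} φ → All (Admissible minus k) (Alt φ) → Rs k φ
  admissible⇒Rs (t ≐ s) _ = r-base z≤n
  admissible⇒Rs ⊥'      _ = r-base z≤n
  admissible⇒Rs (φ ∧' ψ) a = r-∧ (admissible⇒Rs φ (++⁻ˡ (Alt φ) a)) (admissible⇒Rs ψ (++⁻ʳ (Alt φ) a))
  admissible⇒Rs (φ ∨' ψ) a = r-∨ (admissible⇒Rs φ (++⁻ˡ (Alt φ) a)) (admissible⇒Rs ψ (++⁻ʳ (Alt φ) a))
  admissible⇒Rs (φ ⇒ ψ)  a =
    r-⇒ (admissible⇒Js φ (All-admissible-⊥ₚ⁻ (++⁻ˡ (map _⊥ₚ (Alt φ)) a)))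
        (admissible⇒Rs ψ (++⁻ʳ (map _⊥ₚ (Alt φ)) a))
  admissible⇒Rs (∀' φ) a = r-∀ (admissible⇒Rs φ (altQ-admissible⁻ isMinus-tests (Alt φ) a))
  admissible⇒Rs (∃' φ) a = r-base (altQ-admissible-opposite⇒short isPlus-tests (Alt φ) a)

  admissible⇒Js : ∀ {k} φ → All (Admissible plus k) (Alt φ) → Js k φ
  admissible⇒Js (t ≐ s) _ = j-base z≤n
  admissible⇒Js ⊥'      _ = j-base z≤n
  admissible⇒Js (φ ∧' ψ) a = j-∧ (admissible⇒Js φ (++⁻ˡ (Alt φ) a)) (admissible⇒Js ψ (++⁻ʳ (Alt φ) a))
  admissible⇒Js (φ ∨' ψ) a = j-∨ (admissible⇒Js φ (++⁻ˡ (Alt φ) a)) (admissible⇒Js ψ (++⁻ʳ (Alt φ) a))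
  admissible⇒Js (φ ⇒ ψ)  a =
    j-⇒ (admissible⇒Rs φ (All-admissible-⊥ₚ⁻ (++⁻ˡ (map _⊥ₚ (Alt φ)) a)))
        (admissible⇒Js ψ (++⁻ʳ (map _⊥ₚ (Alt φ)) a))
  admissible⇒Js (∃' φ) a = j-∃ (admissible⇒Js φ (altQ-admissible⁻ isPlus-tests (Alt φ) a))
  admissible⇒Js (∀' φ) a = j-base (altQ-admissible-opposite⇒short isMinus-tests (Alt φ) a)

mutual
  Rs⇒admissible : ∀ {k φ} → Rs k φ → All (Admissible minus k) (Alt φ)
  Rs⇒admissible {φ = φ} (r-base d) = All.map (λ {s} → short⇒admissible s) (maxLen≤⇒All (Alt φ) d)
  Rs⇒admissible (r-∧ r r′) = ++⁺ (Rs⇒admissible r) (Rs⇒admissible r′)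
  Rs⇒admissible (r-∨ r r′) = ++⁺ (Rs⇒admissible r) (Rs⇒admissible r′)
  Rs⇒admissible (r-∀ r)    = altQ-admissible isMinus-tests (Rs⇒admissible r)
  Rs⇒admissible (r-⇒ j r)  = ++⁺ (All-admissible-⊥ₚ (Js⇒admissible j)) (Rs⇒admissible r)

  Js⇒admissible : ∀ {k φ} → Js k φ → All (Admissible plus k) (Alt φ)
  Js⇒admissible {φ = φ} (j-base d) = All.map (λ {s} → short⇒admissible s) (maxLen≤⇒All (Alt φ) d)
  Js⇒admissible (j-∧ j j′) = ++⁺ (Js⇒admissible j) (Js⇒admissible j′)
  Js⇒admissible (j-∨ j j′) = ++⁺ (Js⇒admissible j) (Js⇒admissible j′)
  Js⇒admissible (j-∃ j)    = altQ-admissible isPlus-tests (Js⇒admissible j)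
  Js⇒admissible (j-⇒ r j)  = ++⁺ (All-admissible-⊥ₚ (Rs⇒admissible r)) (Js⇒admissible j)

Alt-≢[] : ∀ φ → Alt φ ≢ []
Alt-≢[] (t ≐ s) ()
Alt-≢[] ⊥'      ()
Alt-≢[] (φ ∧' ψ) e = Alt-≢[] ψ (++-conicalʳ (Alt φ) (Alt ψ) e)
Alt-≢[] (φ ∨' ψ) e = Alt-≢[] ψ (++-conicalʳ (Alt φ) (Alt ψ) e)
Alt-≢[] (φ ⇒ ψ)  e = Alt-≢[] ψ (++-conicalʳ (map _⊥ₚ (Alt φ)) (Alt ψ) e)
Alt-≢[] (∀' φ)   e = Alt-≢[] φ (altQ-≡[] isMinus-tests (Alt φ) e)
Alt-≢[] (∃' φ)   e = Alt-≢[] φ (altQ-≡[] isPlus-tests (Alt φ) e)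

startsWith∧short⇒≡[] : ∀ {σ L} → All (StartsWith σ) L → All (LengthAtMost 0) L → L ≡ []
startsWith∧short⇒≡[] []                   []      = refl
startsWith∧short⇒≡[] (_∷_ {_ ∷ _} refl _) (() ∷ _)

quantified-deg≢0 : ∀ {σ p} → Tests σ p → ∀ φ → ¬ All (LengthAtMost 0) (altQ σ p (Alt φ))
quantified-deg≢0 tests φ short =
  Alt-≢[] φ (altQ-≡[] tests (Alt φ) (startsWith∧short⇒≡[] (altQ-startsWith tests (Alt φ)) short))

short0⇒QF : ∀ φ → All (LengthAtMost 0) (Alt φ) → QF φ
short0⇒QF (t ≐ s) _ = _
short0⇒QF ⊥'      _ = _
short0⇒QF (φ ∧' ψ) a = short0⇒QF φ (++⁻ˡ (Alt φ) a) , short0⇒QF ψ (++⁻ʳ (Alt φ) a)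
short0⇒QF (φ ∨' ψ) a = short0⇒QF φ (++⁻ˡ (Alt φ) a) , short0⇒QF ψ (++⁻ʳ (Alt φ) a)
short0⇒QF (φ ⇒ ψ)  a =
  short0⇒QF φ (All.map (λ {s} → subst (_≤ 0) (length-map flipS s)) (map⁻ (++⁻ˡ (map _⊥ₚ (Alt φ)) a))) ,
  short0⇒QF ψ (++⁻ʳ (map _⊥ₚ (Alt φ)) a)
short0⇒QF (∀' φ) a = ⊥-elim (quantified-deg≢0 isMinus-tests φ a)
short0⇒QF (∃' φ) a = ⊥-elim (quantified-deg≢0 isPlus-tests φ a)

QF⇒short0 : ∀ φ → QF φ → All (LengthAtMost 0) (Alt φ)
QF⇒short0 (t ≐ s) _ = z≤n ∷ []
QF⇒short0 ⊥'      _ = z≤n ∷ []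
QF⇒short0 (φ ∧' ψ) (q , q′) = ++⁺ (QF⇒short0 φ q) (QF⇒short0 ψ q′)
QF⇒short0 (φ ∨' ψ) (q , q′) = ++⁺ (QF⇒short0 φ q) (QF⇒short0 ψ q′)
QF⇒short0 (φ ⇒ ψ)  (q , q′) =
  ++⁺ (map⁺ (All.map (λ {s} → subst (_≤ 0) (sym (length-map flipS s))) (QF⇒short0 φ q))) (QF⇒short0 ψ q′)

-- U⁺ 0 and E⁺ 0 are both this class.
deg0⇒QF : ∀ φ → F 0 φ ⊎ deg φ < 0 → QF φ
deg0⇒QF φ (inj₁ d) = short0⇒QF φ (maxLen≤⇒All (Alt φ) (≤-reflexive d))

QF⇒deg0 : ∀ φ → QF φ → F 0 φ ⊎ deg φ < 0
QF⇒deg0 φ q = inj₁ (n≤0⇒n≡0 (All⇒maxLen≤ (QF⇒short0 φ q)))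

⇔'-refl : ∀ {Γ} φ → Γ ⊢ φ ⇔' φ
⇔'-refl φ = ∧-i (⇒-i (hyp (here refl))) (⇒-i (hyp (here refl)))

⊆⇒⊑ : ∀ {C D : Class} → (∀ φ → C φ → D φ) → C ⊑ D
⊆⇒⊑ C⊆D φ c = φ , C⊆D φ c , (λ _ → refl) , ⇔'-refl φ

proposition4p1 : ∀ (k : ℕ) → (U⁺ k ≡HA ℛ k) × (E⁺ k ≡HA 𝒥 k)
proposition4p1 zero = (⊆⇒⊑ deg0⇒QF , ⊆⇒⊑ QF⇒deg0) , (⊆⇒⊑ deg0⇒QF , ⊆⇒⊑ QF⇒deg0)
proposition4p1 (suc k) =
  ( ⊆⇒⊑ (λ φ u → admissible⇒Rs φ (maximalPathsStartWith⇒admissible φ u))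
  , ⊆⇒⊑ (λ φ r → admissible⇒maximalPathsStartWith φ (Rs⇒admissible r)) )
  ,
  ( ⊆⇒⊑ (λ φ e → admissible⇒Js φ (maximalPathsStartWith⇒admissible φ e))
  , ⊆⇒⊑ (λ φ j → admissible⇒maximalPathsStartWith φ (Js⇒admissible j)) )
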